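{- Let $d\ge 0$ be an integer and let $H$ be a graph such that, for every vertex $v\in V(H)$, the neighborhood $N(v)$ of $v$ contains a copy of $K_d$ (i.e. $H[N(v)]$ contains $K_d$ as a subgraph). Then $s(H)\ge d^2$.
   Context: All graphs are finite and simple. For graphs $F$ and $H$, write $F\to H$ if every coloring of the edges of $F$ with two colors contains a monochromatic copy (subgraph isomorphic to) $H$. $F$ is Ramsey $H$-minimal if $F\to H$ and no proper subgraph $F'$ of $F$ satisfies $F'\to H$; $\mathcal{M}(H)$ denotes the set of such graphs. Define $s(H)=\min_{F\in\mathcal{M}(H)}\delta(F)$, where $\delta(F)$ is the minimum degree of $F$. -}

module Defs where

open import Data.Nat using (ℕ; _*_; _≤_)
open import Data.Bool using (Bool; true; false; if_then_else_)
open import Data.Fin using (Fin)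
open import Data.List using (List; map; allFin)
open import Data.Nat.ListAction using (sum)
open import Data.Product using (Σ; _×_; ∃; ∃-syntax)
open import Data.Sum using (_⊎_)
open import Relation.Binary.PropositionalEquality using (_≡_; _≢_)
open import Relation.Nullary using (¬_)
open import Function.Definitions using (Injective)

record Graph : Set where
  field
    n      : ℕ
    adj    : Fin n → Fin n → Bool
    sym    : ∀ i j → adj i j ≡ adj j i
    irrefl : ∀ i → adj i i ≡ false
open Graph public

deg : (G : Graph) → Fin (n G) → ℕ
deg G v = sum (map (λ j → if adj G v j then 1 else 0) (allFin (n G)))

record Subgraph (F : Graph) : Set where
  field
    S     : Fin (n F) → Bool
    E     : Fin (n F) → Fin (n F) → Bool
    E-sym : ∀ i j → E i j ≡ E j i
    E⊆F   : ∀ i j → E i j ≡ true → adj F i j ≡ true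
    E⊆S   : ∀ i j → E i j ≡ true → S i ≡ true
open Subgraph public

full : (F : Graph) → Subgraph F
full F = record
  { S = λ _ → true ; E = adj F ; E-sym = sym F
  ; E⊆F = λ _ _ p → p ; E⊆S = λ _ _ _ → Relation.Binary.PropositionalEquality.refl }

Proper : {F : Graph} → Subgraph F → Set
Proper {F} T = (∃[ v ] S T v ≡ false)
             ⊎ (∃[ i ] ∃[ j ] (adj F i j ≡ true × E T i j ≡ false))

record Colouring (F : Graph) : Set where
  field
    col     : Fin (n F) → Fin (n F) → Bool
    col-sym : ∀ i j → col i j ≡ col j i
open Colouring public

MonoCopy : (F : Graph) → Subgraph F → Colouring F → Bool → Graph → Set
MonoCopy F T c b H =
  Σ (Fin (n H) → Fin (n F)) λ f →
    Injective _≡_ _≡_ f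
    × (∀ i → S T (f i) ≡ true)
    × (∀ i j → adj H i j ≡ true → (E T (f i) (f j) ≡ true × col c (f i) (f j) ≡ b))

-- T → H : every 2-colouring of the edges of T has a monochromatic copy of H.
-- (Colourings of F restricted to E(T) are exactly the colourings of T.)
ArrowsSub : (F : Graph) → Subgraph F → Graph → Set
ArrowsSub F T H = (c : Colouring F) → ∃[ b ] MonoCopy F T c b H

_⟶_ : Graph → Graph → Set
F ⟶ H = ArrowsSub F (full F) H

RamseyMinimal : Graph → Graph → Set
RamseyMinimal F H = (F ⟶ H) × ((T : Subgraph F) → Proper T → ¬ ArrowsSub F T H)

NbhdHasClique : (H : Graph) → Fin (n H) → ℕ → Set
NbhdHasClique H v d =
  Σ (Fin d → Fin (n H)) λ g →
    Injective _≡_ _≡_ g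
    × (∀ i → adj H v (g i) ≡ true)
    × (∀ i j → i ≢ j → adj H (g i) (g j) ≡ true)

MinDegAtLeast : Graph → ℕ → Set
MinDegAtLeast F k = ∀ v → k ≤ deg F v

-- s(H) ≥ k, i.e. min over F ∈ M(H) of δ(F) is ≥ k
sAtLeast : Graph → ℕ → Set
sAtLeast H k = ∀ F → RamseyMinimal F H → MinDegAtLeast F k

module Submission where

-- Suppose a vertex v of F has deg v < d², and let c be a 2-colouring.
-- Greedily choose a maximal family of vertex-disjoint red (colour false)
-- d-cliques inside N(v); each uses d neighbours of v, so fewer than d of
-- them fit.  Recolour every edge vx blue (true) iff x is covered by the
-- family.  Since F → H there is a monochromatic copy of H.  If it passes
-- through v, the K_d in the neighbourhood of the preimage of v becomes a
-- clique in N(v) whose edges and whose edges to v share one colour: if red,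
-- it is an uncovered red clique, against maximality; if blue, its d
-- vertices are covered by fewer than d cliques, so two share a red clique
-- (pigeonhole), yet their edge is blue.  So the copy avoids v and F - v → H,
-- contradicting minimality.

open import Defs
open import Data.Nat using (ℕ; zero; suc; _*_; _+_; _≤_; _<_; z≤n; s≤s; _≤?_)
open import Data.Nat.Properties using (≤-trans; m≤n+m; +-suc; +-identityʳ; ≰⇒>; <⇒≱)
open import Data.Nat.ListAction using (sum)
open import Data.Bool using (Bool; true; false; if_then_else_; _∧_; not)
open import Data.Bool.Properties using (∧-comm) renaming (_≟_ to _≟ᵇ_)
open import Data.Fin using (Fin; zero; suc; punchIn; punchOut; remQuot; combine)
open import Data.Fin.Properties
  using (_≟_; any?; all?; pigeonhole; injective⇒≤; punchIn-injective; punchIn-punchOut;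
         punchOut-injective; punchInᵢ≢i; combine-remQuot; <⇒≢)
open import Data.Vec.Functional using (_∷_)
open import Data.List using (tabulate)
open import Data.List.Properties using (map-tabulate)
open import Data.Product using (Σ; _×_; _,_; proj₁; proj₂; ∃; uncurry)
open import Data.Sum using (_⊎_; inj₁; inj₂)
open import Data.Empty using (⊥; ⊥-elim)
open import Relation.Nullary using (¬_; Dec; yes; no; does)
open import Relation.Nullary.Decidable using (_×-dec_; _→-dec_; ¬?; dec-true; dec-false)
open import Relation.Binary.PropositionalEquality
  using (_≡_; _≢_; _≗_; refl; trans; cong; cong₂; subst; subst₂; module ≡-Reasoning)
  renaming (sym to ≡-sym)
open import Function using (_∘_)
open import Function.Definitions using (Injective)

count : ∀ {N} → (Fin N → Bool) → ℕ
count P = sum (tabulate (λ x → if P x then 1 else 0))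

deg≡count : (G : Graph) (v : Fin (n G)) → deg G v ≡ count (adj G v)
deg≡count G v = cong sum (map-tabulate (λ x → x) (λ j → if adj G v j then 1 else 0))

-- An injection into {x | P x} has at most count P elements in its domain.
-- Induction on N: drop the element zero from the codomain, removing its
-- preimage (if any) from the domain.
injection≤count : ∀ {m N} (P : Fin N → Bool) (f : Fin m → Fin N) →
                  Injective _≡_ _≡_ f → (∀ i → P (f i) ≡ true) → m ≤ count P

avoidingZero : ∀ {k N} (P : Fin (suc N) → Bool) (g : Fin k → Fin (suc N)) →
               Injective _≡_ _≡_ g → (∀ i → P (g i) ≡ true) → (∀ i → zero ≢ g i) →
               k ≤ count (P ∘ suc)
avoidingZero P g g-inj Pg 0≢g =
  injection≤count (P ∘ suc) (λ i → punchOut (0≢g i))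
    (λ {i} {j} e → g-inj (punchOut-injective (0≢g i) (0≢g j) e))
    (λ i → trans (cong P (punchIn-punchOut (0≢g i))) (Pg i))

injection≤count {N = zero} P f f-inj _ = injective⇒≤ f-inj
injection≤count {zero} {suc N} P f _ _ = z≤n
injection≤count {suc m} {suc N} P f f-inj Pf with any? (λ i → f i ≟ zero)
... | no zero∉f =
  ≤-trans (avoidingZero P f f-inj Pf (λ i 0≡fi → zero∉f (i , ≡-sym 0≡fi))) (m≤n+m _ _)
... | yes (i₀ , fi₀≡0) =
  subst (λ b → suc m ≤ (if b then 1 else 0) + count (P ∘ suc))
        (trans (≡-sym (Pf i₀)) (cong P fi₀≡0))
        (s≤s (avoidingZero P (f ∘ punchIn i₀) (λ e → punchIn-injective i₀ _ _ (f-inj e))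
                           (Pf ∘ punchIn i₀) 0∉rest))
  where
  0∉rest : ∀ j → zero ≢ f (punchIn i₀ j)
  0∉rest j 0≡f = punchInᵢ≢i i₀ j (f-inj (trans (≡-sym 0≡f) (≡-sym fi₀≡0)))

∷-≗ : ∀ {m} {A : Set} {x : A} {w w' : Fin m → A} → w ≗ w' → (x ∷ w) ≗ (x ∷ w')
∷-≗ e zero    = refl
∷-≗ e (suc i) = e i

head∷tail : ∀ {m} {A : Set} (w : Fin (suc m) → A) → w ≗ (w zero ∷ w ∘ suc)
head∷tail w zero    = refl
head∷tail w (suc i) = refl

search : ∀ {m N} (P : (Fin m → Fin N) → Set) → (∀ w → Dec (P w)) →
         (∀ {w w'} → w ≗ w' → P w → P w') → Dec (∃ P)
search {zero} P P? resp with P? (λ ())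
... | yes p = yes (_ , p)
... | no ¬p = no λ { (w , p) → ¬p (resp (λ ()) p) }
search {suc m} P P? resp
  with any? (λ x → search (λ w → P (x ∷ w)) (λ w → P? (x ∷ w)) (λ e → resp (∷-≗ e)))
... | yes (x , w , p) = yes (x ∷ w , p)
... | no ¬p = no λ { (w , p) → ¬p (w zero , w ∘ suc , resp (head∷tail w) p) }

does-true : ∀ {A : Set} (a? : Dec A) → does a? ≡ true → A
does-true (yes a) _ = a
does-true (no _) ()

does-false : ∀ {A : Set} (a? : Dec A) → does a? ≡ false → ¬ A
does-false (no ¬a) _ = ¬a
does-false (yes _) ()

adjacent⇒distinct : (G : Graph) {x y : Fin (n G)} → adj G x y ≡ true → x ≢ y
adjacent⇒distinct G {x} e refl with trans (≡-sym e) (irrefl G x)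
... | ()

module Cliques (F : Graph) (v : Fin (n F)) (c : Colouring F) (d : ℕ) where

  MonoClique : Bool → (Fin d → Fin (n F)) → Set
  MonoClique b w = (∀ i → adj F v (w i) ≡ true)
                 × (∀ i i' → i ≢ i' → adj F (w i) (w i') ≡ true × col c (w i) (w i') ≡ b)

  monoClique? : ∀ b w → Dec (MonoClique b w)
  monoClique? b w =
    all? (λ i → adj F v (w i) ≟ᵇ true)
    ×-dec all? (λ i → all? (λ i' → ¬? (i ≟ i') →-dec
                 (adj F (w i) (w i') ≟ᵇ true ×-dec col c (w i) (w i') ≟ᵇ b)))

  monoClique-≗ : ∀ {b w w'} → w ≗ w' → MonoClique b w → MonoClique b w'
  monoClique-≗ {b} e (inN , edges) =
      (λ i → subst (λ x → adj F v x ≡ true) (e i) (inN i))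
    , (λ i i' i≢i' → subst₂ (λ x y → adj F x y ≡ true × col c x y ≡ b) (e i) (e i')
                             (edges i i' i≢i'))

  monoClique-injective : ∀ {b w} → MonoClique b w → Injective _≡_ _≡_ w
  monoClique-injective (_ , edges) {i} {i'} e with i ≟ i'
  ... | yes i≡i' = i≡i'
  ... | no i≢i' = ⊥-elim (adjacent⇒distinct F (proj₁ (edges i i' i≢i')) e)

  record Packing (k : ℕ) : Set where
    field
      block    : Fin k → Fin d → Fin (n F)
      red      : ∀ j → MonoClique false (block j)
      disjoint : ∀ {j j' i i'} → block j i ≡ block j' i' → j ≡ j'
  open Packing

  Covered : ∀ {k} → Packing k → Fin (n F) → Set
  Covered P x = ∃ λ j → ∃ λ i → block P j i ≡ x

  covered? : ∀ {k} (P : Packing k) x → Dec (Covered P x)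
  covered? P x = any? (λ j → any? (λ i → block P j i ≟ x))

  Maximal : ∀ {k} → Packing k → Set
  Maximal P = ∀ w → MonoClique false w → ¬ (∀ i → ¬ Covered P (w i))

  position-unique : ∀ {k} (P : Packing k) {j j' i i'} →
                    block P j i ≡ block P j' i' → j ≡ j' × i ≡ i'
  position-unique P {j} e with disjoint P e
  ... | refl = refl , monoClique-injective (red P j) e

  packing-size : ∀ {k} → Packing k → k * d ≤ deg F v
  packing-size {k} P = subst (k * d ≤_) (≡-sym (deg≡count F v))
                             (injection≤count (adj F v) vertex vertex-injective vertex-adjacent)
    where
    vertex : Fin (k * d) → Fin (n F)
    vertex z = uncurry (block P) (remQuot d z)
    vertex-adjacent : ∀ z → adj F v (vertex z) ≡ true
    vertex-adjacent z = proj₁ (red P (proj₁ (remQuot {k} d z))) (proj₂ (remQuot {k} d z))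
    vertex-injective : Injective _≡_ _≡_ vertex
    vertex-injective {z} {z'} e = begin
      z                                    ≡⟨ ≡-sym (combine-remQuot {k} d z) ⟩
      uncurry combine (remQuot {k} d z)    ≡⟨ cong (uncurry combine)
                                                   (uncurry (cong₂ _,_) (position-unique P e)) ⟩
      uncurry combine (remQuot {k} d z')   ≡⟨ combine-remQuot {k} d z' ⟩
      z'                                   ∎
      where open ≡-Reasoning

  emptyPacking : Packing 0
  emptyPacking = record { block = λ () ; red = λ () ; disjoint = λ { {()} } }

  Fresh : ∀ {k} → Packing k → (Fin d → Fin (n F)) → Set
  Fresh P w = MonoClique false w × (∀ i → ¬ Covered P (w i))

  addBlock : ∀ {k} (P : Packing k) w → Fresh P w → Packing (suc k)
  addBlock P w (redW , freshW) = record
    { block = w ∷ block P ; red = λ { zero → redW ; (suc j) → red P j } ; disjoint = disj }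
    where
    disj : ∀ {j j' i i'} → (w ∷ block P) j i ≡ (w ∷ block P) j' i' → j ≡ j'
    disj {zero}  {zero}            _ = refl
    disj {zero}  {suc j'} {i} {i'} e = ⊥-elim (freshW i (j' , i' , ≡-sym e))
    disj {suc j} {zero}   {i} {i'} e = ⊥-elim (freshW i' (j , i , e))
    disj {suc j} {suc j'}          e = cong suc (disjoint P e)

  fresh? : ∀ {k} (P : Packing k) w → Dec (Fresh P w)
  fresh? P w = monoClique? false w ×-dec all? (λ i → ¬? (covered? P (w i)))

  fresh-≗ : ∀ {k} (P : Packing k) {w w'} → w ≗ w' → Fresh P w → Fresh P w'
  fresh-≗ P e (redW , freshW) =
    monoClique-≗ e redW , λ i → subst (λ x → ¬ Covered P x) (e i) (freshW i)

  extendOrMaximal : ∀ {k} (P : Packing k) → Packing (suc k) ⊎ Maximal P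
  extendOrMaximal P with search (Fresh P) (fresh? P) (fresh-≗ P)
  ... | yes (w , freshW) = inj₁ (addBlock P w freshW)
  ... | no noFresh = inj₂ λ w redW uncovered → noFresh (w , redW , uncovered)

  MaximalBelow : ℕ → Set
  MaximalBelow s = ∃ λ k → k < s × Σ (Packing k) Maximal

  grow : ∀ fuel {k} → Packing k → Packing (fuel + k) ⊎ MaximalBelow (fuel + k)
  grow zero P = inj₁ P
  grow (suc fuel) {k} P with extendOrMaximal P
  ... | inj₂ maximal = inj₂ (k , s≤s (m≤n+m k fuel) , P , maximal)
  ... | inj₁ P′ = subst (λ s → Packing s ⊎ MaximalBelow s) (+-suc fuel k) (grow fuel P′)

  -- If deg v < d·d, a packing of d blocks cannot exist, so the greedy
  -- procedure stops at a maximal packing of fewer than d blocks.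
  maximalPacking : deg F v < d * d → MaximalBelow d
  maximalPacking small
    with subst (λ s → Packing s ⊎ MaximalBelow s) (+-identityʳ d) (grow d emptyPacking)
  ... | inj₁ P     = ⊥-elim (<⇒≱ small (packing-size P))
  ... | inj₂ found = found

  sameBlock-notBlue : ∀ {k} (P : Packing k) {x y} (px : Covered P x) (py : Covered P y) →
                      proj₁ px ≡ proj₁ py → adj F x y ≡ true → col c x y ≡ true → ⊥
  sameBlock-notBlue P (j , a , refl) (.j , a' , refl) refl adjacent blue with a ≟ a'
  ... | yes refl = adjacent⇒distinct F adjacent refl
  ... | no a≢a' with trans (≡-sym blue) (proj₂ (proj₂ (red P j) a a' a≢a'))
  ...   | ()

  coverColour : ∀ {k} → Packing k → Fin (n F) → Bool
  coverColour P x = does (covered? P x)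

  position : ∀ {k} (P : Packing k) (w : Fin d → Fin (n F)) →
             (∀ i → coverColour P (w i) ≡ true) → ∀ i → Covered P (w i)
  position P w covered i = does-true (covered? P (w i)) (covered i)

  -- For a maximal packing of fewer than d blocks, no d-clique in
  -- N(v) of colour b has all its vertices of cover colour b: a red one would
  -- be fresh, and a blue one has d covered vertices in fewer than d blocks,
  -- so by pigeonhole two of them share a (red) block.
  noMatchingClique : ∀ {k} (P : Packing k) → k < d → Maximal P →
                     ∀ b w → MonoClique b w → (∀ i → coverColour P (w i) ≡ b) → ⊥
  noMatchingClique P k<d maximal false w redW uncovered =
    maximal w redW (λ i → does-false (covered? P (w i)) (uncovered i))
  noMatchingClique P k<d maximal true w (_ , edges) covered =
    let i , i' , i<i' , sameBlock = pigeonhole k<d (λ i → proj₁ (position P w covered i))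
    in sameBlock-notBlue P (position P w covered i) (position P w covered i') sameBlock
                         (proj₁ (edges i i' (<⇒≢ i<i'))) (proj₂ (edges i i' (<⇒≢ i<i')))

module Recolour (F : Graph) (v : Fin (n F)) (c : Colouring F) (σ : Fin (n F) → Bool) where

  recol : Fin (n F) → Fin (n F) → Bool
  recol x y = if does (x ≟ v) then σ y else if does (y ≟ v) then σ x else col c x y

  recol-sym : ∀ x y → recol x y ≡ recol y x
  recol-sym x y with x ≟ v | y ≟ v
  ... | yes refl | yes refl = refl
  ... | yes _    | no _     = refl
  ... | no _     | yes _    = refl
  ... | no _     | no _     = col-sym c x y

  recolouring : Colouring F
  recolouring = record { col = recol ; col-sym = recol-sym }

  recol-at-v : ∀ y → recol v y ≡ σ y
  recol-at-v y rewrite dec-true (v ≟ v) refl = refl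

  recol-off : ∀ {x y} → x ≢ v → y ≢ v → recol x y ≡ col c x y
  recol-off {x} {y} x≢v y≢v rewrite dec-false (x ≟ v) x≢v | dec-false (y ≟ v) y≢v = refl

open Recolour using (recolouring; recol-at-v; recol-off)

keep : ∀ {N} → Fin N → Fin N → Bool
keep v x = not (does (x ≟ v))

keep-v : ∀ {N} (v : Fin N) → keep v v ≡ false
keep-v v = cong not (dec-true (v ≟ v) refl)

keep-other : ∀ {N} {v x : Fin N} → x ≢ v → keep v x ≡ true
keep-other x≢v = cong not (dec-false (_ ≟ _) x≢v)

∧-true : ∀ {a b} → a ∧ b ≡ true → a ≡ true × b ≡ true
∧-true {true}  e  = refl , e
∧-true {false} ()

deleteVertex : (F : Graph) → Fin (n F) → Subgraph F
deleteVertex F v = record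
  { S     = keep v
  ; E     = λ x y → (keep v x ∧ keep v y) ∧ adj F x y
  ; E-sym = λ x y → cong₂ _∧_ (∧-comm (keep v x) (keep v y)) (sym F x y)
  ; E⊆F   = λ x y e → proj₂ (∧-true e)
  ; E⊆S   = λ x y e → proj₁ (∧-true (proj₁ (∧-true e)))
  }

copyAvoiding : ∀ F v c σ {H b} (copy : MonoCopy F (full F) (recolouring F v c σ) b H) →
               (∀ i → proj₁ copy i ≢ v) → MonoCopy F (deleteVertex F v) c b H
copyAvoiding F v c σ {H} {b} (f , f-inj , _ , f-edges) avoids =
  f , f-inj , (λ i → keep-other (avoids i)) , edges
  where
  edges : ∀ i j → adj H i j ≡ true →
          ((keep v (f i) ∧ keep v (f j)) ∧ adj F (f i) (f j)) ≡ true × col c (f i) (f j) ≡ b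
  edges i j a rewrite keep-other (avoids i) | keep-other (avoids j) =
    let adjacent , colour = f-edges i j a
    in adjacent , trans (≡-sym (recol-off F v c σ (avoids i) (avoids j))) colour

copyThroughV : ∀ F v c σ d {H b} (copy : MonoCopy F (full F) (recolouring F v c σ) b H) →
               ∀ u → proj₁ copy u ≡ v → NbhdHasClique H u d →
               ∃ λ w → Cliques.MonoClique F v c d b w × (∀ i → σ (w i) ≡ b)
copyThroughV F .(f u) c σ d {H} {b} (f , f-inj , _ , f-edges) u refl (g , _ , g-nbr , g-clique) =
  f ∘ g , (inN , edges) , matching
  where
  w≢v : ∀ i → f (g i) ≢ f u
  w≢v i e = adjacent⇒distinct H (g-nbr i) (≡-sym (f-inj e))
  inN : ∀ i → adj F (f u) (f (g i)) ≡ true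
  inN i = proj₁ (f-edges u (g i) (g-nbr i))
  edges : ∀ i i' → i ≢ i' → adj F (f (g i)) (f (g i')) ≡ true × col c (f (g i)) (f (g i')) ≡ b
  edges i i' i≢i' =
    let adjacent , colour = f-edges (g i) (g i') (g-clique i i' i≢i')
    in adjacent , trans (≡-sym (recol-off F (f u) c σ (w≢v i) (w≢v i'))) colour
  matching : ∀ i → σ (f (g i)) ≡ b
  matching i = trans (≡-sym (recol-at-v F (f u) c σ (f (g i))))
                     (proj₂ (f-edges u (g i) (g-nbr i)))

deleteLowDegree : ∀ d H → (∀ u → NbhdHasClique H u d) → ∀ F v → deg F v < d * d →
                  F ⟶ H → ArrowsSub F (deleteVertex F v) H
deleteLowDegree d H cliques F v small F→H c = useCopy (maximalPacking small)
  where
  open Cliques F v c d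
  useCopy : MaximalBelow d → ∃ λ b → MonoCopy F (deleteVertex F v) c b H
  useCopy (k , k<d , P , maximal) with F→H (recolouring F v c (coverColour P))
  ... | b , copy with any? (λ u → proj₁ copy u ≟ v)
  ...   | no avoids = b , copyAvoiding F v c (coverColour P) {H} copy (λ i e → avoids (i , e))
  ...   | yes (u , fu≡v) =
    let w , mono , matching = copyThroughV F v c (coverColour P) d {H} {b} copy u fu≡v (cliques u)
    in ⊥-elim (noMatchingClique P k<d maximal b w mono matching)

lemma3p2 : (d : ℕ) (H : Graph) → (∀ v → NbhdHasClique H v d) → sAtLeast H (d * d)
lemma3p2 d H cliques F (F→H , minimal) v with d * d ≤? deg F v
... | yes enough  = enough
... | no tooSmall = ⊥-elim (minimal (deleteVertex F v) (inj₁ (v , keep-v v))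
                                    (deleteLowDegree d H cliques F v (≰⇒> tooSmall) F→H))
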